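{- (Linearity of evaluation.) (1) $\vec 0\succ\!\!\succ\vec 0$. (2) If $\vec t\succ\!\!\succ\vec t'$ then $\alpha\cdot\vec t\succ\!\!\succ\alpha\cdot\vec t'$ for all $\alpha\in\mathbb C$. (3) If $\vec t_1\succ\!\!\succ\vec t_1'$ and $\vec t_2\succ\!\!\succ\vec t_2'$ then $\vec t_1+\vec t_2\succ\!\!\succ\vec t_1'+\vec t_2'$.
   Context: Calculus. Fix a denumerable set of variables. Pure values: $v,w::=x\mid\lambda x.\vec s\mid *\mid(v_1,v_2)\mid\mathrm{inl}(v)\mid\mathrm{inr}(v)$. Pure terms: $s,t::=v\mid s\,t\mid t;\vec s\mid \mathrm{let}\,(x_1,x_2)=t\,\mathrm{in}\,\vec s\mid\mathrm{match}\,t\,\{\mathrm{inl}(x_1)\mapsto\vec s_1\mid\mathrm{inr}(x_2)\mapsto\vec s_2\}$. Term distributions: $\vec s,\vec t::=\vec 0\mid t\mid\vec s+\vec t\mid\alpha\cdot\vec t$ ($\alpha\in\mathbb C$). Terms up to $\alpha$-conversion; top-level distributions modulo the congruence $\equiv$ generated by: $+$ associative, commutative with neutral $\vec0$; $1\cdot\vec t\equiv\vec t$; $\alpha\cdot(\beta\cdot\vec t)\equiv\alpha\beta\cdot\vec t$; $(\alpha+\beta)\cdot\vec t\equiv\alpha\cdot\vec t+\beta\cdot\vec t$; $\alpha\cdot(\vec t_1+\vec t_2)\equiv\alpha\cdot\vec t_1+\alpha\cdot\vec t_2$ (not going inside pure terms; $0\cdot t\not\equiv\vec0$). Constructs extended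 by linearity: pairs and application bilinear, inl/inr linear, sequence/let/match linear in the destructed argument. $\vec t[x:=w]$ is capture-avoiding substitution of a pure value $w$. Atomic evaluation $t\triangleright\vec t'$ is generated by $(\lambda x.\vec t)\,v\triangleright\vec t[x:=v]$; $*;\vec s\triangleright\vec s$; $\mathrm{let}\,(x,y)=(v,w)\,\mathrm{in}\,\vec s\triangleright\vec s[x:=v,y:=w]$; match on $\mathrm{inl}(v)$/$\mathrm{inr}(v)$ gives $\vec s_1[x_1:=v]$/$\vec s_2[x_2:=v]$ ($v,w$ pure values); and, if $t\triangleright\vec t'$: $s\,t\triangleright s\,\vec t'$, $t\,v\triangleright\vec t'\,v$, $t;\vec s\triangleright\vec t';\vec s$, and the same in the destructed position of let and match. $\vec t\succ\vec t'$ iff $\vec t\equiv\alpha\cdot s+\vec r$, $\vec t'\equiv\alpha\cdot\vec s'+\vec r$ for some $\alpha\in\mathbb C$, pure term $s$, distributions $\vec s',\vec r$ with $s\triangleright\vec s'$. $\succ\!\!\succ$ is the reflexive–transitive closure of $\succ$. -}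

module Defs where

open import Level using (_⊔_)
open import Data.Nat using (ℕ; zero; suc)
open import Data.Product using (Σ; ∃; _×_; _,_)
open import Algebra.Bundles using (CommutativeRing)
open import Relation.Binary.Construct.Closure.ReflexiveTransitive using (Star)

module Calculus {c ℓ} (R : CommutativeRing c ℓ) where

  open CommutativeRing R using (Carrier; _≈_; _*_; _+_; 1#)

  infixl 6 _⊕_
  infixr 7 _⊙_

  mutual
    data Val : Set c where
      var  : ℕ → Val
      lam  : Dist → Val              -- λ binds index 0 in the body
      unit : Val
      pair : Val → Val → Val
      inl  : Val → Val
      inr  : Val → Val

    data Term : Set c where
      val   : Val → Term
      app   : Term → Term → Term
      seq   : Term → Dist → Term
      letp  : Term → Dist → Term     -- let (x₁,x₂) = t in s⃗ ; x₁ = index 1, x₂ = index 0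
      match : Term → Dist → Dist → Term  -- each branch binds index 0

    -- term distributions (formal syntax; identified up to _≃_ only at top level)
    data Dist : Set c where
      𝟎   : Dist
      ⟨_⟩ : Term → Dist
      _⊕_ : Dist → Dist → Dist
      _⊙_ : Carrier → Dist → Dist

  infix 4 _≃_
  data _≃_ : Dist → Dist → Set (c ⊔ ℓ) where
    ≃-refl  : ∀ {d} → d ≃ d
    ≃-sym   : ∀ {d e} → d ≃ e → e ≃ d
    ≃-trans : ∀ {d e f} → d ≃ e → e ≃ f → d ≃ f
    ⊕-cong  : ∀ {d d' e e'} → d ≃ d' → e ≃ e' → d ⊕ e ≃ d' ⊕ e'
    ⊙-cong  : ∀ {α β d e} → α ≈ β → d ≃ e → α ⊙ d ≃ β ⊙ e
    ⊕-assoc : ∀ {d e f} → (d ⊕ e) ⊕ f ≃ d ⊕ (e ⊕ f)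
    ⊕-comm  : ∀ {d e} → d ⊕ e ≃ e ⊕ d
    ⊕-idʳ   : ∀ {d} → d ⊕ 𝟎 ≃ d
    ⊙-one   : ∀ {d} → 1# ⊙ d ≃ d
    ⊙-assoc : ∀ {α β d} → α ⊙ (β ⊙ d) ≃ (α * β) ⊙ d
    ⊙-distˢ : ∀ {α β d} → (α + β) ⊙ d ≃ α ⊙ d ⊕ β ⊙ d
    ⊙-distᵈ : ∀ {α d e} → α ⊙ (d ⊕ e) ≃ α ⊙ d ⊕ α ⊙ e

  ext : (ℕ → ℕ) → ℕ → ℕ
  ext ρ zero    = zero
  ext ρ (suc n) = suc (ρ n)

  mutual
    renV : (ℕ → ℕ) → Val → Val
    renV ρ (var x)    = var (ρ x)
    renV ρ (lam d)    = lam (renD (ext ρ) d)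
    renV ρ unit       = unit
    renV ρ (pair v w) = pair (renV ρ v) (renV ρ w)
    renV ρ (inl v)    = inl (renV ρ v)
    renV ρ (inr v)    = inr (renV ρ v)

    renT : (ℕ → ℕ) → Term → Term
    renT ρ (val v)         = val (renV ρ v)
    renT ρ (app s t)       = app (renT ρ s) (renT ρ t)
    renT ρ (seq t d)       = seq (renT ρ t) (renD ρ d)
    renT ρ (letp t d)      = letp (renT ρ t) (renD (ext (ext ρ)) d)
    renT ρ (match t d₁ d₂) = match (renT ρ t) (renD (ext ρ) d₁) (renD (ext ρ) d₂)

    renD : (ℕ → ℕ) → Dist → Dist
    renD ρ 𝟎       = 𝟎
    renD ρ ⟨ t ⟩   = ⟨ renT ρ t ⟩
    renD ρ (d ⊕ e) = renD ρ d ⊕ renD ρ e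
    renD ρ (α ⊙ d) = α ⊙ renD ρ d

  exts : (ℕ → Val) → ℕ → Val
  exts σ zero    = var zero
  exts σ (suc n) = renV suc (σ n)

  mutual
    subV : (ℕ → Val) → Val → Val
    subV σ (var x)    = σ x
    subV σ (lam d)    = lam (subD (exts σ) d)
    subV σ unit       = unit
    subV σ (pair v w) = pair (subV σ v) (subV σ w)
    subV σ (inl v)    = inl (subV σ v)
    subV σ (inr v)    = inr (subV σ v)

    subT : (ℕ → Val) → Term → Term
    subT σ (val v)         = val (subV σ v)
    subT σ (app s t)       = app (subT σ s) (subT σ t)
    subT σ (seq t d)       = seq (subT σ t) (subD σ d)
    subT σ (letp t d)      = letp (subT σ t) (subD (exts (exts σ)) d)
    subT σ (match t d₁ d₂) = match (subT σ t) (subD (exts σ) d₁) (subD (exts σ) d₂)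

    subD : (ℕ → Val) → Dist → Dist
    subD σ 𝟎       = 𝟎
    subD σ ⟨ t ⟩   = ⟨ subT σ t ⟩
    subD σ (d ⊕ e) = subD σ d ⊕ subD σ e
    subD σ (α ⊙ d) = α ⊙ subD σ d

  σ₁ : Val → ℕ → Val
  σ₁ v zero    = v
  σ₁ v (suc n) = var n

  σ₂ : Val → Val → ℕ → Val
  σ₂ v w zero          = w
  σ₂ v w (suc zero)    = v
  σ₂ v w (suc (suc n)) = var n

  -- extension of the constructs by linearity in the distribution argument
  -- (generic: lift a pure-term context to distributions)
  lin : (Term → Term) → Dist → Dist
  lin C 𝟎       = 𝟎
  lin C ⟨ t ⟩   = ⟨ C t ⟩
  lin C (d ⊕ e) = lin C d ⊕ lin C e
  lin C (α ⊙ d) = α ⊙ lin C d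

  infix 4 _▷_
  data _▷_ : Term → Dist → Set c where
    β-lam   : ∀ {d v} → app (val (lam d)) (val v) ▷ subD (σ₁ v) d
    β-seq   : ∀ {d} → seq (val unit) d ▷ d
    β-let   : ∀ {v w d} → letp (val (pair v w)) d ▷ subD (σ₂ v w) d
    β-inl   : ∀ {v d₁ d₂} → match (val (inl v)) d₁ d₂ ▷ subD (σ₁ v) d₁
    β-inr   : ∀ {v d₁ d₂} → match (val (inr v)) d₁ d₂ ▷ subD (σ₁ v) d₂
    ξ-appʳ  : ∀ {s t d} → t ▷ d → app s t ▷ lin (app s) d
    ξ-appˡ  : ∀ {t v d} → t ▷ d → app t (val v) ▷ lin (λ u → app u (val v)) d
    ξ-seq   : ∀ {t s d} → t ▷ d → seq t s ▷ lin (λ u → seq u s) d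
    ξ-let   : ∀ {t s d} → t ▷ d → letp t s ▷ lin (λ u → letp u s) d
    ξ-match : ∀ {t s₁ s₂ d} → t ▷ d → match t s₁ s₂ ▷ lin (λ u → match u s₁ s₂) d

  infix 4 _≻_ _≻≻_
  _≻_ : Dist → Dist → Set (c ⊔ ℓ)
  d ≻ d' = Σ Carrier λ α → Σ Term λ s → Σ Dist λ s' → Σ Dist λ r →
             (s ▷ s') × (d ≃ α ⊙ ⟨ s ⟩ ⊕ r) × (d' ≃ α ⊙ s' ⊕ r)

  _≻≻_ : Dist → Dist → Set (c ⊔ ℓ)
  _≻≻_ = Star _≻_

module Submission where

open import Defs
open import Data.Product using (_×_; _,_)
open import Algebra.Bundles using (CommutativeRing)
open import Relation.Binary.Construct.Closure.ReflexiveTransitive using (ε; _◅◅_; gmap)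

-- A step rewrites one redex α ⊙ ⟨ s ⟩ inside a remainder r; scaling or extending the
-- distribution only rescales the redex and enlarges the remainder, so each step lifts,
-- and the multi-step statements follow step by step.

module Linearity {c ℓ} (R : CommutativeRing c ℓ) where
  open Calculus R
  open CommutativeRing R using (_*_; refl)

  ⊙-distrib-redex : ∀ α β {d r} → α ⊙ (β ⊙ d ⊕ r) ≃ (α * β) ⊙ d ⊕ α ⊙ r
  ⊙-distrib-redex α β = ≃-trans ⊙-distᵈ (⊕-cong ⊙-assoc ≃-refl)

  ⊙-mono-≻ : ∀ α {d d'} → d ≻ d' → α ⊙ d ≻ α ⊙ d'
  ⊙-mono-≻ α (β , s , s' , r , s▷s' , d≃ , d'≃) =
    α * β , s , s' , α ⊙ r , s▷s' ,
    ≃-trans (⊙-cong refl d≃) (⊙-distrib-redex α β) ,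
    ≃-trans (⊙-cong refl d'≃) (⊙-distrib-redex α β)

  ⊕-monoˡ-≻ : ∀ e {d d'} → d ≻ d' → d ⊕ e ≻ d' ⊕ e
  ⊕-monoˡ-≻ e (β , s , s' , r , s▷s' , d≃ , d'≃) =
    β , s , s' , r ⊕ e , s▷s' ,
    ≃-trans (⊕-cong d≃ ≃-refl) ⊕-assoc ,
    ≃-trans (⊕-cong d'≃ ≃-refl) ⊕-assoc

  ⊕-monoʳ-≻ : ∀ d {e e'} → e ≻ e' → d ⊕ e ≻ d ⊕ e'
  ⊕-monoʳ-≻ d (β , s , s' , r , s▷s' , e≃ , e'≃) =
    β , s , s' , r ⊕ d , s▷s' ,
    ≃-trans ⊕-comm (≃-trans (⊕-cong e≃ ≃-refl) ⊕-assoc) ,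
    ≃-trans ⊕-comm (≃-trans (⊕-cong e'≃ ≃-refl) ⊕-assoc)

  ⊙-mono-≻≻ : ∀ α {d d'} → d ≻≻ d' → α ⊙ d ≻≻ α ⊙ d'
  ⊙-mono-≻≻ α = gmap (α ⊙_) (⊙-mono-≻ α)

  ⊕-mono-≻≻ : ∀ {d d' e e'} → d ≻≻ d' → e ≻≻ e' → d ⊕ e ≻≻ d' ⊕ e'
  ⊕-mono-≻≻ {d' = d'} {e = e} d≻≻d' e≻≻e' =
    gmap (_⊕ e) (⊕-monoˡ-≻ e) d≻≻d' ◅◅ gmap (d' ⊕_) (⊕-monoʳ-≻ d') e≻≻e'

proposition3 : ∀ {c ℓ} (R : CommutativeRing c ℓ) → let open Calculus R in
    (𝟎 ≻≻ 𝟎)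
    × (∀ (α : CommutativeRing.Carrier R) {t t' : Dist} → t ≻≻ t' → α ⊙ t ≻≻ α ⊙ t')
    × (∀ {t₁ t₁' t₂ t₂' : Dist} → t₁ ≻≻ t₁' → t₂ ≻≻ t₂' → t₁ ⊕ t₂ ≻≻ t₁' ⊕ t₂')
proposition3 R = ε , ⊙-mono-≻≻ , ⊕-mono-≻≻
  where open Linearity R
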